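{- Let $G_{243,22}=\{x\in\mathbb{F}_{243}:x^{22}=1\}$. Then $G_{243,22}$ is a complete cap set in $\mathbb{F}_{243}$, and it has the smallest possible size among complete cap sets in $\mathbb{F}_{243}$: every complete cap set in $\mathbb{F}_{243}$ has at least $22$ elements.
   Context: A subset $S\subseteq\mathbb{F}_{243}$ is a cap set if there are no pairwise distinct $a,b,c\in S$ with $a+b+c=0$. A cap set $S$ is complete if for every $x\in\mathbb{F}_{243}\setminus S$ there exist distinct $y,z\in S$ with $x+y+z=0$ (equivalently, $S$ is not contained in a strictly larger cap set). -}

module Defs where

open import Data.Nat using (ℕ; zero; suc)
open import Data.Vec using (Vec; []; _∷_; zipWith; map; replicate)
open import Data.List using (List)
open import Data.List.Membership.Propositional using (_∈_)
open import Data.Product using (Σ; _×_; ∃-syntax)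
open import Relation.Binary.PropositionalEquality using (_≡_; _≢_)
open import Relation.Nullary using (¬_)

data F3 : Set where
  z0 z1 z2 : F3

_+₃_ : F3 → F3 → F3
z0 +₃ b = b
z1 +₃ z0 = z1
z1 +₃ z1 = z2
z1 +₃ z2 = z0
z2 +₃ z0 = z2
z2 +₃ z1 = z0
z2 +₃ z2 = z1

_*₃_ : F3 → F3 → F3
z0 *₃ b = z0
z1 *₃ b = b
z2 *₃ z0 = z0
z2 *₃ z1 = z2
z2 *₃ z2 = z1

-- F_243 = F_3[X]/(X^5 + 2X + 1)  (X^5 + 2X + 1 is irreducible over F_3;
-- it is the Conway polynomial for 3^5).  An element is the coefficient
-- vector (a0, a1, a2, a3, a4) of a0 + a1 X + ... + a4 X^4.
F243 : Set
F243 = Vec F3 5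

0F : F243
0F = replicate 5 z0

1F : F243
1F = z1 ∷ z0 ∷ z0 ∷ z0 ∷ z0 ∷ []

_+F_ : F243 → F243 → F243
_+F_ = zipWith _+₃_

scaleF : F3 → F243 → F243
scaleF c = map (c *₃_)

-- multiplication by X, using X^5 = X + 2 (i.e. X^5 = -2X - 1)
mulX : F243 → F243
mulX (a0 ∷ a1 ∷ a2 ∷ a3 ∷ a4 ∷ []) =
  (z2 *₃ a4) ∷ (a0 +₃ a4) ∷ a1 ∷ a2 ∷ a3 ∷ []

mulAux : ∀ {n} → F243 → Vec F3 n → F243
mulAux a [] = 0F
mulAux a (b ∷ bs) = scaleF b a +F mulX (mulAux a bs)

_*F_ : F243 → F243 → F243
a *F b = mulAux a b

_^F_ : F243 → ℕ → F243
x ^F zero = 1F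
x ^F suc n = x *F (x ^F n)

IsCapSet : (F243 → Set) → Set
IsCapSet S = ∀ a b c → S a → S b → S c →
  a ≢ b → b ≢ c → a ≢ c → (a +F b) +F c ≢ 0F

IsComplete : (F243 → Set) → Set
IsComplete S = ∀ x → ¬ S x →
  ∃[ y ] ∃[ z ] (S y × S z × y ≢ z × (x +F y) +F z ≡ 0F)

IsCompleteCapSet : (F243 → Set) → Set
IsCompleteCapSet S = IsCapSet S × IsComplete S

G243-22 : F243 → Set
G243-22 x = x ^F 22 ≡ 1F

{-# OPTIONS --safe #-}

-- G₂₂ is obtained by filtering the 243 field elements, after which "complete cap set" is a
-- finite check, done by decision procedures for IsCapSet and IsComplete of a listed set.
-- Lower bound: in characteristic 3, x + y + z = 0 forces x = -(y + z), so a complete set S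
-- covers the field with S and the points -(y + z) for the unordered pairs {y, z} ⊆ S.
-- Hence 243 ≤ |S| + C(|S|, 2) = C(|S| + 1, 2), while C(22, 2) = 231.
module Submission where

open import Defs
open import Data.Nat using (ℕ; suc; _+_; _≤_; _≤′_; ≤′-refl; ≤′-step)
open import Data.Nat.Properties
  using (≤-refl; ≤-trans; ≤-reflexive; m≤n+m; m≤m+n; ≮⇒≥; ≤⇒≯; <-≤-trans; ≤⇒≤′; module ≤-Reasoning)
open import Data.Nat.Combinatorics using (_C_; nC1≡n; nCk+nC[k+1]≡[n+1]C[k+1])
open import Data.Fin using (zero; suc)
open import Data.Fin.Properties using (injective⇒≤)
open import Data.List using (List; []; _∷_; _++_; length; map; filter; lookup; cartesianProductWith)
open import Data.List.Properties using (length-++; length-map)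
open import Data.List.Membership.Propositional using (_∈_; find; lose)
open import Data.List.Membership.Propositional.Properties
  using (∈-map⁺; ∈-++⁺ˡ; ∈-++⁺ʳ; ∈-filter⁺; ∈-filter⁻; ∈-lookup; ∈-cartesianProductWith⁺)
open import Data.List.Membership.Setoid.Properties using (index-injective)
open import Data.List.Relation.Unary.Any using (here; there; any?)
open import Data.List.Relation.Unary.All as All using (all?; []; _∷_)
open import Data.List.Relation.Unary.AllPairs using ([]; _∷_)
open import Data.List.Relation.Unary.Unique.Propositional using (Unique)
open import Data.List.Relation.Unary.Unique.Propositional.Properties
  using (cartesianProductWith⁺; filter⁺)
open import Data.Empty using (⊥-elim)
open import Data.Product using (_×_; _,_; proj₂; uncurry; ∃-syntax)
open import Data.Sum using (_⊎_; inj₁; inj₂)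
open import Data.Vec as Vec using (Vec; []; _∷_; zipWith; replicate)
open import Data.Vec.Properties using (≡-dec; ∷-injective; ∷-injectiveˡ; ∷-injectiveʳ; zipWith-comm)
open import Function using (_∘_)
open import Function.Bundles using (_⇔_; mk⇔; Equivalence)
open import Relation.Binary.Definitions using (DecidableEquality)
open import Relation.Binary.PropositionalEquality
  using (_≡_; _≢_; refl; sym; trans; subst; cong; cong₂; setoid; module ≡-Reasoning)
open import Relation.Nullary using (Dec; yes; no; ¬?)
open import Relation.Nullary.Decidable using (map′; from-yes; _×-dec_; _→-dec_)
open import Relation.Unary using (Decidable)

module _ {A : Set} where

  ∀∈? : {P : A → Set} → Decidable P → (xs : List A) → Dec (∀ {x} → x ∈ xs → P x)
  ∀∈? P? xs = map′ All.lookup All.tabulate (all? P? xs)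

  ∃∈? : {P : A → Set} → Decidable P → (xs : List A) → Dec (∃[ x ] (x ∈ xs × P x))
  ∃∈? P? xs = map′ find (λ (_ , x∈xs , px) → lose x∈xs px) (any? P? xs)

  ∀? : {P : A → Set} {xs : List A} → (∀ x → x ∈ xs) → Decidable P → Dec (∀ x → P x)
  ∀? ∈xs P? = map′ (λ p x → p (∈xs x)) (λ p {x} _ → p x) (∀∈? P? _)

  vectors : List A → (n : ℕ) → List (Vec A n)
  vectors xs 0       = [] ∷ []
  vectors xs (suc n) = cartesianProductWith _∷_ xs (vectors xs n)

  ∈-vectors : {xs : List A} → (∀ x → x ∈ xs) → ∀ {n} (v : Vec A n) → v ∈ vectors xs n
  ∈-vectors ∈xs []      = here refl
  ∈-vectors ∈xs (a ∷ v) = ∈-cartesianProductWith⁺ _∷_ (∈xs a) (∈-vectors ∈xs v)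

  vectors-unique : {xs : List A} → Unique xs → ∀ n → Unique (vectors xs n)
  vectors-unique u 0       = [] ∷ []
  vectors-unique u (suc n) = cartesianProductWith⁺ _∷_ ∷-injective u (vectors-unique u n)

  pairs : List A → List (A × A)
  pairs []       = []
  pairs (x ∷ xs) = map (x ,_) xs ++ pairs xs

  length-pairs : ∀ xs → length (pairs xs) ≡ length xs C 2
  length-pairs []       = refl
  length-pairs (x ∷ xs) = begin
    length (map (x ,_) xs ++ pairs xs)    ≡⟨ length-++ (map (x ,_) xs) ⟩
    length (map (x ,_) xs) + length (pairs xs)
      ≡⟨ cong₂ _+_ (trans (length-map (x ,_) xs) (sym (nC1≡n (length xs)))) (length-pairs xs) ⟩
    length xs C 1 + length xs C 2         ≡⟨ nCk+nC[k+1]≡[n+1]C[k+1] (length xs) 1 ⟩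
    suc (length xs) C 2                   ∎
    where open ≡-Reasoning

  ∈-pairs : ∀ {y z} {xs : List A} → y ∈ xs → z ∈ xs → y ≢ z →
            (y , z) ∈ pairs xs ⊎ (z , y) ∈ pairs xs
  ∈-pairs (here refl) (here refl) y≢z = ⊥-elim (y≢z refl)
  ∈-pairs (here refl) (there z∈) _    = inj₁ (∈-++⁺ˡ (∈-map⁺ _ z∈))
  ∈-pairs (there y∈) (here refl) _    = inj₂ (∈-++⁺ˡ (∈-map⁺ _ y∈))
  ∈-pairs {xs = x ∷ xs} (there y∈) (there z∈) y≢z with ∈-pairs y∈ z∈ y≢z
  ... | inj₁ yz∈ = inj₁ (∈-++⁺ʳ (map (x ,_) xs) yz∈)
  ... | inj₂ zy∈ = inj₂ (∈-++⁺ʳ (map (x ,_) xs) zy∈)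

  ∈-map-pairs : ∀ {B : Set} (f : A → A → B) → (∀ y z → f y z ≡ f z y) →
                ∀ {y z xs} → y ∈ xs → z ∈ xs → y ≢ z → f y z ∈ map (uncurry f) (pairs xs)
  ∈-map-pairs f f-comm {y} {z} y∈ z∈ y≢z with ∈-pairs y∈ z∈ y≢z
  ... | inj₁ yz∈ = ∈-map⁺ (uncurry f) yz∈
  ... | inj₂ zy∈ rewrite f-comm y z = ∈-map⁺ (uncurry f) zy∈

  Unique⇒lookup-injective : ∀ {xs : List A} → Unique xs →
                            ∀ {i j} → lookup xs i ≡ lookup xs j → i ≡ j
  Unique⇒lookup-injective (x∉ ∷ u) {zero}  {zero}  _  = refl
  Unique⇒lookup-injective (x∉ ∷ u) {zero}  {suc j} eq = ⊥-elim (All.lookup x∉ (∈-lookup j) eq)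
  Unique⇒lookup-injective (x∉ ∷ u) {suc i} {zero}  eq = ⊥-elim (All.lookup x∉ (∈-lookup i) (sym eq))
  Unique⇒lookup-injective (x∉ ∷ u) {suc i} {suc j} eq = cong suc (Unique⇒lookup-injective u eq)

  Unique⇒⊆⇒length≤ : ∀ {xs ys : List A} → Unique xs → (∀ {x} → x ∈ xs → x ∈ ys) →
                     length xs ≤ length ys
  Unique⇒⊆⇒length≤ u xs⊆ys = injective⇒≤ λ eq → Unique⇒lookup-injective u
    (index-injective (setoid A) (xs⊆ys (∈-lookup _)) (xs⊆ys (∈-lookup _)) eq)

nCk≤[1+n]Ck : ∀ n k → n C k ≤ suc n C k
nCk≤[1+n]Ck n 0       = ≤-refl
nCk≤[1+n]Ck n (suc k) =
  ≤-trans (m≤n+m (n C suc k) (n C k)) (≤-reflexive (nCk+nC[k+1]≡[n+1]C[k+1] n k))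

C-monoˡ-≤′ : ∀ k {m n} → m ≤′ n → m C k ≤ n C k
C-monoˡ-≤′ k ≤′-refl        = ≤-refl
C-monoˡ-≤′ k (≤′-step m≤′n) = ≤-trans (C-monoˡ-≤′ k m≤′n) (nCk≤[1+n]Ck _ k)

243≤[1+n]C2⇒22≤n : ∀ n → 243 ≤ suc n C 2 → 22 ≤ n
243≤[1+n]C2⇒22≤n n 243≤ = ≮⇒≥ λ n<22 →
  ≤⇒≯ (C-monoˡ-≤′ 2 (≤⇒≤′ n<22)) (<-≤-trans (m≤m+n 232 11) 243≤)

infix 4 _≟₃_ _≟_

_≟₃_ : DecidableEquality F3
z0 ≟₃ z0 = yes refl
z1 ≟₃ z1 = yes refl
z2 ≟₃ z2 = yes refl
z0 ≟₃ z1 = no λ ()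
z0 ≟₃ z2 = no λ ()
z1 ≟₃ z0 = no λ ()
z1 ≟₃ z2 = no λ ()
z2 ≟₃ z0 = no λ ()
z2 ≟₃ z1 = no λ ()

F3-elements : List F3
F3-elements = z0 ∷ z1 ∷ z2 ∷ []

∈-F3-elements : ∀ a → a ∈ F3-elements
∈-F3-elements z0 = here refl
∈-F3-elements z1 = there (here refl)
∈-F3-elements z2 = there (there (here refl))

F3-elements-unique : Unique F3-elements
F3-elements-unique = ((λ ()) ∷ (λ ()) ∷ []) ∷ ((λ ()) ∷ []) ∷ [] ∷ []

-₃_ : F3 → F3
-₃ z0 = z0
-₃ z1 = z2
-₃ z2 = z1

+₃-comm : ∀ a b → a +₃ b ≡ b +₃ a
+₃-comm = from-yes (∀? ∈-F3-elements λ a → ∀? ∈-F3-elements λ b → a +₃ b ≟₃ b +₃ a)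

a+b+c≡0⇒a≡-[b+c] : ∀ a b c → (a +₃ b) +₃ c ≡ z0 → a ≡ -₃ (b +₃ c)
a+b+c≡0⇒a≡-[b+c] = from-yes
  (∀? ∈-F3-elements λ a → ∀? ∈-F3-elements λ b → ∀? ∈-F3-elements λ c →
    (a +₃ b) +₃ c ≟₃ z0 →-dec a ≟₃ -₃ (b +₃ c))

third : ∀ {n} → Vec F3 n → Vec F3 n → Vec F3 n
third y z = Vec.map -₃_ (zipWith _+₃_ y z)

third-comm : ∀ {n} (y z : Vec F3 n) → third y z ≡ third z y
third-comm y z = cong (Vec.map -₃_) (zipWith-comm +₃-comm y z)

sum≡0⇒≡third : ∀ {n} (x y z : Vec F3 n) →
  zipWith _+₃_ (zipWith _+₃_ x y) z ≡ replicate n z0 → x ≡ third y z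
sum≡0⇒≡third []      []      []      _  = refl
sum≡0⇒≡third (a ∷ x) (b ∷ y) (c ∷ z) eq =
  cong₂ _∷_ (a+b+c≡0⇒a≡-[b+c] a b c (∷-injectiveˡ eq)) (sum≡0⇒≡third x y z (∷-injectiveʳ eq))

_≟_ : DecidableEquality F243
_≟_ = ≡-dec _≟₃_

open import Data.List.Membership.DecPropositional _≟_ using (_∈?_)

F243-elements : List F243
F243-elements = vectors F3-elements 5

∈-F243-elements : ∀ x → x ∈ F243-elements
∈-F243-elements = ∈-vectors ∈-F3-elements

F243-elements-unique : Unique F243-elements
F243-elements-unique = vectors-unique F3-elements-unique 5

module _ {P Q : F243 → Set} (P⇔Q : ∀ x → P x ⇔ Q x) where
  open Equivalence

  IsCapSet-resp-⇔ : IsCapSet P → IsCapSet Q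
  IsCapSet-resp-⇔ cap a b c qa qb qc =
    cap a b c (from (P⇔Q a) qa) (from (P⇔Q b) qb) (from (P⇔Q c) qc)

  IsComplete-resp-⇔ : IsComplete P → IsComplete Q
  IsComplete-resp-⇔ complete x ¬qx with y , z , py , pz , rest ← complete x (¬qx ∘ to (P⇔Q x)) =
    y , z , to (P⇔Q y) py , to (P⇔Q z) pz , rest

isCapSet? : ∀ xs → Dec (IsCapSet (_∈ xs))
isCapSet? xs = map′
  (λ cap a b c a∈ b∈ c∈ → cap {a} a∈ {b} b∈ {c} c∈)
  (λ cap {a} a∈ {b} b∈ {c} c∈ → cap a b c a∈ b∈ c∈)
  (∀∈? (λ a → ∀∈? (λ b → ∀∈? (λ c →
    ¬? (a ≟ b) →-dec ¬? (b ≟ c) →-dec ¬? (a ≟ c) →-dec ¬? ((a +F b) +F c ≟ 0F)) xs) xs) xs)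

isComplete? : ∀ xs → Dec (IsComplete (_∈ xs))
isComplete? xs = ∀? ∈-F243-elements λ x → ¬? (x ∈? xs) →-dec completes? x
  where
  completes? : ∀ x → Dec (∃[ y ] ∃[ z ] (y ∈ xs × z ∈ xs × y ≢ z × (x +F y) +F z ≡ 0F))
  completes? x = map′
    (λ (y , y∈ , z , z∈ , p) → y , z , y∈ , z∈ , p)
    (λ (y , z , y∈ , z∈ , p) → y , y∈ , z , z∈ , p)
    (∃∈? (λ y → ∃∈? (λ z → ¬? (y ≟ z) ×-dec (x +F y) +F z ≟ 0F) xs) xs)

G243-22? : Decidable G243-22
G243-22? x = x ^F 22 ≟ 1F

G243-22-elements : List F243
G243-22-elements = filter G243-22? F243-elements

∈-G243-22-elements⇔ : ∀ x → x ∈ G243-22-elements ⇔ G243-22 x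
∈-G243-22-elements⇔ x = mk⇔
  (proj₂ ∘ ∈-filter⁻ G243-22? {xs = F243-elements})
  (∈-filter⁺ G243-22? (∈-F243-elements x))

G243-22-complete-cap-set : IsCompleteCapSet G243-22
G243-22-complete-cap-set =
  IsCapSet-resp-⇔ ∈-G243-22-elements⇔ (from-yes (isCapSet? G243-22-elements)) ,
  IsComplete-resp-⇔ ∈-G243-22-elements⇔ (from-yes (isComplete? G243-22-elements))

∈-complete-covers : ∀ S → IsComplete (_∈ S) → ∀ x → x ∈ S ++ map (uncurry third) (pairs S)
∈-complete-covers S complete x with x ∈? S
... | yes x∈S = ∈-++⁺ˡ x∈S
... | no x∉S =
  let y , z , y∈S , z∈S , y≢z , sum≡0 = complete x x∉S in
  subst (_∈ _) (sym (sum≡0⇒≡third x y z sum≡0))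
    (∈-++⁺ʳ S (∈-map-pairs third third-comm y∈S z∈S y≢z))

complete⇒243≤[1+length]C2 : ∀ S → IsComplete (_∈ S) → 243 ≤ suc (length S) C 2
complete⇒243≤[1+length]C2 S complete = begin
  243                                           ≡⟨⟩
  length F243-elements                          ≤⟨ Unique⇒⊆⇒length≤ F243-elements-unique
                                                     (λ {x} _ → ∈-complete-covers S complete x) ⟩
  length (S ++ map (uncurry third) (pairs S))   ≡⟨ length-++ S ⟩
  length S + length (map (uncurry third) (pairs S))
    ≡⟨ cong₂ _+_ (sym (nC1≡n (length S))) (trans (length-map _ (pairs S)) (length-pairs S)) ⟩
  length S C 1 + length S C 2                   ≡⟨ nCk+nC[k+1]≡[n+1]C[k+1] (length S) 1 ⟩
  suc (length S) C 2                            ∎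
  where open ≤-Reasoning

mainTheorem11 : IsCompleteCapSet G243-22
    × (∃[ L ] (Unique L × (∀ x → (x ∈ L) ⇔ G243-22 x) × length L ≡ 22))
    × (∀ (S : List F243) → Unique S → IsCompleteCapSet (λ x → x ∈ S) → 22 ≤ length S)
mainTheorem11 =
  G243-22-complete-cap-set ,
  (G243-22-elements , filter⁺ G243-22? F243-elements-unique , ∈-G243-22-elements⇔ , refl) ,
  λ S _ (_ , complete) → 243≤[1+n]C2⇒22≤n (length S) (complete⇒243≤[1+length]C2 S complete)
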